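{- Let $q$ be a prime power, $m,n,k,\rho$ positive integers, let $\mathcal{C}$ be a nondegenerate $[n,k]_{q^m/q}$ rank-metric code and let $\mathcal{U}$ be an $[n,k]_{q^m/q}$ system associated with $\mathcal{C}$. Then $\mathcal{U}$ is rank-$\rho$-saturating if and only if $\rho_{\mathrm{rk}}(\mathcal{C}^\perp)=\rho$.
   Context: An $[n,k]_{q^m/q}$ code is a $k$-dimensional $\mathbb{F}_{q^m}$-subspace of $\mathbb{F}_{q^m}^{1\times n}$; a generator matrix is a $k\times n$ matrix over $\mathbb{F}_{q^m}$ whose rows form a basis. It is nondegenerate if the $\mathbb{F}_q$-span of the columns of a generator matrix has $\mathbb{F}_q$-dimension $n$. A system associated with $\mathcal{C}$ is the $\mathbb{F}_q$-span of the columns of a generator matrix of $\mathcal{C}$. The dual is $\mathcal{C}^\perp=\{v\in\mathbb{F}_{q^m}^{1\times n}: \sum_j v_jc_j=0\ \forall c\in\mathcal{C}\}$. Rank weight: $\mathrm{wt}_{\mathrm{rk}}(x)=\dim_{\mathbb{F}_q}\langle x_1,\ldots,x_n\rangle_{\mathbb{F}_q}$; rank distance $d_{\mathrm{rk}}(x,y)=\mathrm{wt}_{\mathrm{rk}}(x-y)$. The rank covering radius of a code $\mathcal{D}\le\mathbb{F}_{q^m}^{1\times n}$ is $\rho_{\mathrm{rk}}(\mathcal{D})=\max_{x\in\mathbb{F}_{q^m}^{1\times n}}\min_{c\in\mathcal{D}} d_{\mathrm{rk}}(x,c)$. An $[n,k]_{q^m/q}$ system is an $n$-dimensional $\mathbb{F}_q$-subspace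 $\mathcal{U}\le\mathbb{F}_{q^m}^k$ with $\langle\mathcal{U}\rangle_{\mathbb{F}_{q^m}}=\mathbb{F}_{q^m}^k$; its linear set is $L_\mathcal{U}=\{\langle u\rangle_{\mathbb{F}_{q^m}}: u\in\mathcal{U}\setminus\{0\}\}\subseteq\mathrm{PG}(k-1,q^m)$. A set $\mathcal{S}$ of points of $\mathrm{PG}(k-1,q^m)$ is $r$-saturating if every point lies in the projective subspace spanned by some $r+1$ points of $\mathcal{S}$ and $r$ is the smallest such integer. $\mathcal{U}$ is rank-$\rho$-saturating if $L_\mathcal{U}$ is $(\rho-1)$-saturating. -}

module Defs where

open import Level using (0ℓ)
open import Data.Nat as ℕ using (ℕ; zero; suc)
open import Data.Nat.Primality using (Prime)
open import Data.Fin using (Fin)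
import Data.Fin as Fin
open import Data.Product using (Σ; ∃; ∃-syntax; _×_; _,_; proj₁)
open import Relation.Nullary using (¬_)
open import Relation.Binary.PropositionalEquality using (_≡_)
open import Algebra.Bundles using (CommutativeRing)

record Field : Set₁ where
  field
    commRing : CommutativeRing 0ℓ 0ℓ
  open CommutativeRing commRing public
  field
    0≉1     : ¬ (0# ≈ 1#)
    inverse : ∀ x → ¬ (x ≈ 0#) → ∃[ y ] (x * y ≈ 1#)

module FieldTheory (L : Field) where
  open Field L

  ∑ : ∀ {n} → (Fin n → Carrier) → Carrier
  ∑ {zero}  f = 0#
  ∑ {suc n} f = f Fin.zero + ∑ (λ i → f (Fin.suc i))

  Vect : ℕ → Set
  Vect n = Fin n → Carrier

  _≈ᵛ_ : ∀ {n} → Vect n → Vect n → Set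
  x ≈ᵛ y = ∀ i → x i ≈ y i

  0ᵛ : ∀ {n} → Vect n
  0ᵛ _ = 0#

  _-ᵛ_ : ∀ {n} → Vect n → Vect n → Vect n
  (x -ᵛ y) i = x i - y i

  record Subfield : Set₁ where
    field
      inK      : Carrier → Set
      resp     : ∀ {x y} → x ≈ y → inK x → inK y
      0∈       : inK 0#
      1∈       : inK 1#
      +∈       : ∀ {x y} → inK x → inK y → inK (x + y)
      *∈       : ∀ {x y} → inK x → inK y → inK (x * y)
      -∈       : ∀ {x} → inK x → inK (- x)
      inv∈     : ∀ {x y} → inK x → x * y ≈ 1# → inK y

  module OverSubfield (K : Subfield) where
    open Subfield K

    KCoeffs : ℕ → Set
    KCoeffs s = Σ (Fin s → Carrier) (λ a → ∀ i → inK (a i))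

    KIndependent : ∀ {s} → (Fin s → Carrier) → Set
    KIndependent {s} b = ∀ (a : KCoeffs s) →
      ∑ (λ i → proj₁ a i * b i) ≈ 0# → ∀ i → proj₁ a i ≈ 0#

    InKSpan : ∀ {s} → (Fin s → Carrier) → Carrier → Set
    InKSpan {s} b x = Σ (KCoeffs s) λ a → x ≈ ∑ (λ i → proj₁ a i * b i)

    HasCardinality : ℕ → Set
    HasCardinality q = Σ (Fin q → Carrier) λ e →
      (∀ i → inK (e i)) × (∀ i j → e i ≈ e j → i ≡ j) ×
      (∀ x → inK x → ∃[ i ] (x ≈ e i))

    HasDegree : ℕ → Set
    HasDegree m = Σ (Fin m → Carrier) λ b → KIndependent b × (∀ x → InKSpan b x)

    -- rank weight: wt_rk(x) = dim_K ⟨x_1,…,x_n⟩_K.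
    -- "wt_rk(x) ≤ r" iff the K-span of the entries of x is contained in
    -- the K-span of some r elements of L.
    RankWeight≤ : ∀ {n} → Vect n → ℕ → Set
    RankWeight≤ x r = ∃[ b ] (∀ j → InKSpan {r} b (x j))

    -- the rank covering radius of a code D ⊆ L^n (given by a membership
    -- predicate) equals ρ (for ρ ≥ 1):
    -- every x is within rank distance ρ of D, and some x is at rank
    -- distance > ρ - 1 from every codeword (so max_x min_c d = ρ).
    RankCoveringRadius : ∀ {n} → (Vect n → Set) → ℕ → Set
    RankCoveringRadius {n} D ρ =
      (∀ (x : Vect n) → ∃[ c ] (D c × RankWeight≤ (x -ᵛ c) ρ)) ×
      (∃[ x ] (∀ c → D c → ¬ RankWeight≤ (x -ᵛ c) (ρ ℕ.∸ 1)))

    Matrix : ℕ → ℕ → Set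
    Matrix k n = Fin k → Fin n → Carrier

    FullRowRank : ∀ {k n} → Matrix k n → Set
    FullRowRank {k} {n} G =
      ∀ (λs : Vect k) → (∀ j → ∑ (λ i → λs i * G i j) ≈ 0#) → ∀ i → λs i ≈ 0#

    column : ∀ {k n} → Matrix k n → Fin n → Vect k
    column G j i = G i j

    -- nondegenerate: the K-span of the n columns has K-dimension n,
    -- i.e. the columns are K-linearly independent
    Nondegenerate : ∀ {k n} → Matrix k n → Set
    Nondegenerate {k} {n} G = ∀ (a : KCoeffs n) →
      (∀ i → ∑ (λ j → proj₁ a j * G i j) ≈ 0#) → ∀ j → proj₁ a j ≈ 0#

    InDual : ∀ {k n} → Matrix k n → Vect n → Set
    InDual G v = ∀ i → ∑ (λ j → v j * G i j) ≈ 0#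

    -- the system U associated with G: K-span of the columns of G
    InSystem : ∀ {k n} → Matrix k n → Vect k → Set
    InSystem {k} {n} G u = Σ (KCoeffs n) λ a →
      u ≈ᵛ (λ i → ∑ (λ j → proj₁ a j * G i j))

    -- every point ⟨y⟩ of PG(k-1,q^m) lies in the projective subspace
    -- spanned by some s points ⟨u_1⟩,…,⟨u_s⟩ of the linear set L_U
    -- (u_t ∈ U ∖ {0})
    EveryPointInSpanOf : ∀ {k n} → Matrix k n → ℕ → Set
    EveryPointInSpanOf {k} G s =
      ∀ (y : Vect k) → ¬ (y ≈ᵛ 0ᵛ) →
        Σ (Fin s → Vect k) λ u →
          (∀ t → InSystem G (u t) × ¬ (u t ≈ᵛ 0ᵛ)) ×
          Σ (Fin s → Carrier) λ λs → (y ≈ᵛ (λ i → ∑ (λ t → λs t * u t i)))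

    Saturating : ∀ {k n} → Matrix k n → ℕ → Set
    Saturating G r = EveryPointInSpanOf G (suc r) ×
      (∀ r' → r' ℕ.< r → ¬ EveryPointInSpanOf G (suc r'))

    RankSaturating : ∀ {k n} → Matrix k n → ℕ → Set
    RankSaturating G ρ = Saturating G (ρ ℕ.∸ 1)

IsPrimePower : ℕ → Set
IsPrimePower q = ∃[ p ] ∃[ e ] (Prime p × q ≡ p ℕ.^ suc e)

-- The map x ↦ Gx is onto L^k (G has full row rank) and sends C^⊥ to 0, so
-- the cosets x + C^⊥ are the fibres over the syndromes Gx.  A vector x of
-- rank weight ≤ s is x = Σ_t λ_t a_t with K-vectors a_1,…,a_s, hence Gx is
-- an L-combination of the s vectors G a_t of the system U; conversely every
-- such combination is the syndrome of a vector of rank weight ≤ s.  Thus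
-- "every coset contains a vector of rank weight ≤ s" says exactly that every
-- point of PG(k-1, q^m) lies in the span of s points of L_U.  Finiteness of
-- L makes both properties decidable, which turns the failure of covering
-- into an explicit vector far from C^⊥.

module Submission where

open import Defs
open import Data.Nat using (ℕ; NonZero; zero; suc; _≤_; _<_; _≤′_; ≤′-reflexive; ≤′-step)
open import Data.Product using (_×_; Σ; ∃; ∃-syntax; _,_; proj₁; proj₂)
open import Function.Bundles using (_⇔_; mk⇔)
open import Level using (0ℓ)
open import Data.Nat.Properties using (≤⇒≤′; n<1+n)
open import Data.Fin using (Fin; zero; suc)
open import Data.Fin.Properties using (any?; all?; ¬∀⟶∃¬) renaming (_≟_ to _≟ᶠ_)
open import Data.Vec.Functional using (_∷_; head; tail)
open import Data.Vec.Functional.Relation.Binary.Pointwise using (Pointwise)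
open import Data.Sum using (_⊎_; inj₁; inj₂)
open import Data.Empty using (⊥-elim)
open import Function using (_∘_)
open import Relation.Nullary using (¬_; Dec; yes; no; ¬?; _×-dec_)
open import Relation.Nullary.Decidable using (map′; decidable-stable)
open import Relation.Unary using (Pred; Decidable)
open import Relation.Binary.Core using (Rel)
open import Relation.Binary.Definitions using (Reflexive; Symmetric; _Respects_)
open import Relation.Binary.PropositionalEquality as ≡ using (_≡_)
import Algebra.Properties.Ring as RingProperties
import Algebra.Properties.Semiring.Sum as SemiringSum
import Relation.Binary.Reasoning.Setoid as SetoidReasoning

Searchable : (A : Set) → Rel A 0ℓ → Set₁
Searchable A _~_ = ∀ (P : Pred A 0ℓ) → P Respects _~_ → Decidable P → Dec (∃ P)

Fin-searchable : ∀ n → Searchable (Fin n) _≡_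
Fin-searchable n P _ P? = any? P?

→-searchable : ∀ {A _~_} → Reflexive _~_ → Searchable A _~_ →
               ∀ n → Searchable (Fin n → A) (Pointwise _~_)
→-searchable _ _ zero P resp P? with P? (λ ())
... | yes p = yes (_ , p)
... | no ¬p = no λ (f , p) → ¬p (resp (λ ()) p)
→-searchable {_~_ = _~_} ~-refl search (suc n) P resp P?
  with search (λ a → ∃ λ f → P (a ∷ f)) head-resp
         (λ a → →-searchable ~-refl search n (P ∘ (a ∷_)) (tail-resp a) (P? ∘ (a ∷_)))
  where
  head-resp : (λ a → ∃ λ f → P (a ∷ f)) Respects _~_
  head-resp a~b (f , p) = f , resp (λ { zero → a~b ; (suc i) → ~-refl }) p
  tail-resp : ∀ a → (P ∘ (a ∷_)) Respects Pointwise _~_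
  tail-resp a f~g = resp λ { zero → ~-refl ; (suc i) → f~g i }
... | yes (a , f , p) = yes (a ∷ f , p)
... | no ¬p = no λ (f , p) →
  ¬p (head f , tail f , resp (λ { zero → ~-refl ; (suc i) → ~-refl }) p)

image-searchable : ∀ {A B _~_ _≈_} → Searchable B _≈_ →
  (f : B → A) → (∀ {b b′} → b ≈ b′ → f b ~ f b′) → (∀ a → ∃ λ b → a ~ f b) →
  Searchable A _~_
image-searchable search f f-cong f-onto P resp P?
  with search (P ∘ f) (resp ∘ f-cong) (P? ∘ f)
... | yes (b , p) = yes (f b , p)
... | no ¬p = no λ (a , p) → ¬p (proj₁ (f-onto a) , resp (proj₂ (f-onto a)) p)

counterexample : ∀ {A _~_} → Searchable A _~_ → Symmetric _~_ →
  (Q : Pred A 0ℓ) → Q Respects _~_ → Decidable Q → ¬ (∀ a → Q a) → ∃ λ a → ¬ Q a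
counterexample search ~-sym Q resp Q? ¬∀Q
  with search (¬_ ∘ Q) (λ a~b ¬Qa → ¬Qa ∘ resp (~-sym a~b)) (¬? ∘ Q?)
... | yes found = found
... | no none = ⊥-elim (¬∀Q λ a → decidable-stable (Q? a) λ ¬Qa → none (a , ¬Qa))

module FiniteSums (L : Field) where
  open Field L hiding (zero)
  open FieldTheory L using (∑; Vect; _-ᵛ_)
  open RingProperties ring using (-0#≈0#; -‿+-comm; [y-z]x≈yx-zx)
  open SemiringSum semiring using (sum; sum-cong-≋; sum-replicate-zero;
    ∑-distrib-+; ∑-comm; *-distribˡ-sum; *-distribʳ-sum)
  open SetoidReasoning setoid

  ∑≡sum : ∀ {n} (f : Vect n) → ∑ f ≡ sum f
  ∑≡sum {zero}  f = ≡.refl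
  ∑≡sum {suc n} f = ≡.cong (f zero +_) (∑≡sum (f ∘ suc))

  ∑-cong : ∀ {n} {f g : Vect n} → (∀ i → f i ≈ g i) → ∑ f ≈ ∑ g
  ∑-cong {f = f} {g} f≈g rewrite ∑≡sum f | ∑≡sum g = sum-cong-≋ f≈g

  ∑-zero : ∀ {n} {f : Vect n} → (∀ i → f i ≈ 0#) → ∑ f ≈ 0#
  ∑-zero {n} f≈0 = trans (∑-cong {g = λ _ → 0#} f≈0)
                         (trans (reflexive (∑≡sum {n} (λ _ → 0#))) (sum-replicate-zero n))

  ∑-+ : ∀ {n} (f g : Vect n) → ∑ (λ i → f i + g i) ≈ ∑ f + ∑ g
  ∑-+ f g rewrite ∑≡sum (λ i → f i + g i) | ∑≡sum f | ∑≡sum g = ∑-distrib-+ f g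

  *-distribˡ-∑ : ∀ {n} x (f : Vect n) → x * ∑ f ≈ ∑ (λ i → x * f i)
  *-distribˡ-∑ x f rewrite ∑≡sum f | ∑≡sum (λ i → x * f i) = *-distribˡ-sum x f

  *-distribʳ-∑ : ∀ {n} x (f : Vect n) → ∑ f * x ≈ ∑ (λ i → f i * x)
  *-distribʳ-∑ x f rewrite ∑≡sum f | ∑≡sum (λ i → f i * x) = *-distribʳ-sum x f

  ∑-swap : ∀ {m n} (f : Fin m → Vect n) →
           ∑ (λ i → ∑ (λ j → f i j)) ≈ ∑ (λ j → ∑ (λ i → f i j))
  ∑-swap f = begin
    ∑ (λ i → ∑ (f i))               ≈⟨ ∑-cong (λ i → reflexive (∑≡sum (f i))) ⟩
    ∑ (λ i → sum (f i))             ≡⟨ ∑≡sum (λ i → sum (f i)) ⟩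
    sum (λ i → sum (f i))           ≈⟨ ∑-comm f ⟩
    sum (λ j → sum (λ i → f i j))   ≡⟨ ∑≡sum (λ j → sum (λ i → f i j)) ⟨
    ∑ (λ j → sum (λ i → f i j))     ≈⟨ ∑-cong (λ j → reflexive (∑≡sum (λ i → f i j))) ⟨
    ∑ (λ j → ∑ (λ i → f i j))       ∎

  ∑-neg : ∀ {n} (f : Vect n) → ∑ (λ i → - f i) ≈ - ∑ f
  ∑-neg {zero}  f = sym -0#≈0#
  ∑-neg {suc n} f = trans (+-congˡ (∑-neg (f ∘ suc))) (-‿+-comm _ _)

  ∑-- : ∀ {n} (f g : Vect n) → ∑ (λ i → f i - g i) ≈ ∑ f - ∑ g
  ∑-- f g = trans (∑-+ f (λ i → - g i)) (+-congˡ (∑-neg g))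

  δ : ∀ {n} → Fin n → Vect n
  δ zero    zero    = 1#
  δ zero    (suc j) = 0#
  δ (suc i) zero    = 0#
  δ (suc i) (suc j) = δ i j

  δ-diagonal : ∀ {n} (i : Fin n) → δ i i ≡ 1#
  δ-diagonal zero    = ≡.refl
  δ-diagonal (suc i) = δ-diagonal i

  infixr 25 _*ᵛ_
  _*ᵛ_ : ∀ {n} → Carrier → Vect n → Vect n
  (c *ᵛ v) i = c * v i

  infixl 8 _·_
  _·_ : ∀ {n} → Vect n → Vect n → Carrier
  u · v = ∑ (λ i → u i * v i)

  δ-· : ∀ {n} (i : Fin n) (v : Vect n) → δ i · v ≈ v i
  δ-· zero    v = trans (+-cong (*-identityˡ _) (∑-zero (λ j → zeroˡ (v (suc j))))) (+-identityʳ _)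
  δ-· (suc i) v = trans (+-cong (zeroˡ _) (δ-· i (tail v))) (+-identityˡ _)

  ·-comm : ∀ {n} (u v : Vect n) → u · v ≈ v · u
  ·-comm u v = ∑-cong (λ i → *-comm (u i) (v i))

  *ᵛ-· : ∀ {n} c (u v : Vect n) → (c *ᵛ u) · v ≈ c * (u · v)
  *ᵛ-· c u v = trans (∑-cong (λ i → *-assoc c (u i) (v i)))
                    (sym (*-distribˡ-∑ c (λ i → u i * v i)))

  -ᵛ-· : ∀ {n} (u w v : Vect n) → (u -ᵛ w) · v ≈ u · v - w · v
  -ᵛ-· u w v = trans (∑-cong (λ i → [y-z]x≈yx-zx (v i) (u i) (w i)))
                    (∑-- (λ i → u i * v i) (λ i → w i * v i))

  ·-linearˡ : ∀ {n} (u w v : Vect n) c → (u -ᵛ c *ᵛ w) · v ≈ u · v - c * (w · v)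
  ·-linearˡ u w v c = trans (-ᵛ-· u (c *ᵛ w) v) (+-congˡ (-‿cong (*ᵛ-· c w v)))

  ·-linearʳ : ∀ {n} (u v w : Vect n) c → u · (v -ᵛ c *ᵛ w) ≈ u · v - c * (u · w)
  ·-linearʳ u v w c = begin
    u · (v -ᵛ c *ᵛ w)     ≈⟨ ·-comm u _ ⟩
    (v -ᵛ c *ᵛ w) · u     ≈⟨ ·-linearˡ v w u c ⟩
    v · u - c * (w · u)   ≈⟨ +-cong (·-comm v u) (-‿cong (*-congˡ (·-comm w u))) ⟩
    u · v - c * (u · w)   ∎

module FredholmAlternative (L : Field) (_≟0 : ∀ x → Dec (Field._≈_ L x (Field.0# L))) where
  open Field L hiding (zero)
  open FieldTheory L using (∑; Vect; _-ᵛ_)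
  open FiniteSums L
  open RingProperties ring using (xyx⁻¹≈y; x≈y⇒x∙y⁻¹≈ε)
  open SetoidReasoning setoid

  Solvable : ∀ {k n} → (Fin k → Vect n) → Vect k → Set
  Solvable G y = ∃[ x ] (∀ i → x · G i ≈ y i)

  Obstructed : ∀ {k n} → (Fin k → Vect n) → Vect k → Set
  Obstructed G y = ∃[ l ] ((∀ j → l · (λ i → G i j) ≈ 0#) × l · y ≈ 1#)

  solvable⊎obstructed-0 : ∀ {k} (G : Fin k → Vect 0) y → Solvable G y ⊎ Obstructed G y
  solvable⊎obstructed-0 G y with all? (λ i → y i ≟0)
  ... | yes y≈0 = inj₁ ((λ ()) , λ i → sym (y≈0 i))
  ... | no y≉0 with ¬∀⟶∃¬ _ _ (λ i → y i ≟0) y≉0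
  ...   | i , yᵢ≉0 with inverse (y i) yᵢ≉0
  ...     | z , yᵢz≈1 = inj₂ (z *ᵛ δ i , (λ ()) , (begin
    (z *ᵛ δ i) · y ≈⟨ *ᵛ-· z (δ i) y ⟩
    z * (δ i · y)  ≈⟨ *-congˡ (δ-· i y) ⟩
    z * y i        ≈⟨ *-comm z (y i) ⟩
    y i * z        ≈⟨ yᵢz≈1 ⟩
    1#             ∎))

  module _ {k n} (G : Fin k → Vect (suc n)) (y : Vect k) where
    private
      g : Vect k
      g i = head (G i)
      G′ : Fin k → Vect n
      G′ = tail ∘ G

    solvable-extend : Solvable G′ y → Solvable G y
    solvable-extend (x , x·G′≈y) = 0# ∷ x , λ i →
      trans (+-cong (zeroˡ _) (x·G′≈y i)) (+-identityˡ _)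

    solvable-shift : ∀ β → Solvable G′ (y -ᵛ β *ᵛ g) → Solvable G y
    solvable-shift β (x , x·G′≈) = β ∷ x , λ i → begin
      β * g i + x · G′ i           ≈⟨ +-congˡ (x·G′≈ i) ⟩
      β * g i + (y i - β * g i)    ≈⟨ +-assoc _ _ _ ⟨
      β * g i + y i - β * g i      ≈⟨ xyx⁻¹≈y (β * g i) (y i) ⟩
      y i                          ∎

    -- With α = l · g and α β = 1, the vector μ - (μ · g) β l keeps killing
    -- the columns of G′, also kills g, and still pairs to 1 with y.
    obstructed-combine : ∀ l μ β →
      (∀ j → l · (λ i → G′ i j) ≈ 0#) → l · y ≈ 1# → l · g * β ≈ 1# →
      (∀ j → μ · (λ i → G′ i j) ≈ 0#) → μ · (y -ᵛ β *ᵛ g) ≈ 1# → Obstructed G y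
    obstructed-combine l μ β lG′≈0 ly≈1 αβ≈1 μG′≈0 μy′≈1 =
      ν , (λ { zero → νg≈0 ; (suc j) → νG′≈0 j }) , νy≈1
      where
      c : Carrier
      c = μ · g * β
      ν : Vect k
      ν = μ -ᵛ c *ᵛ l
      νg≈0 : ν · g ≈ 0#
      νg≈0 = begin
        ν · g                           ≈⟨ ·-linearˡ μ l g c ⟩
        μ · g - c * (l · g)             ≈⟨ +-congˡ (-‿cong (*-assoc _ β _)) ⟩
        μ · g - μ · g * (β * (l · g))   ≈⟨ +-congˡ (-‿cong (*-congˡ (trans (*-comm β _) αβ≈1))) ⟩
        μ · g - μ · g * 1#              ≈⟨ x≈y⇒x∙y⁻¹≈ε (sym (*-identityʳ _)) ⟩
        0#                              ∎
      νG′≈0 : ∀ j → ν · (λ i → G′ i j) ≈ 0#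
      νG′≈0 j = begin
        ν · (λ i → G′ i j)
          ≈⟨ ·-linearˡ μ l _ c ⟩
        μ · (λ i → G′ i j) - c * (l · (λ i → G′ i j))
          ≈⟨ +-cong (μG′≈0 j) (-‿cong (*-congˡ (lG′≈0 j))) ⟩
        0# - c * 0#
          ≈⟨ x≈y⇒x∙y⁻¹≈ε (sym (zeroʳ c)) ⟩
        0#
          ∎
      νy≈1 : ν · y ≈ 1#
      νy≈1 = begin
        ν · y                 ≈⟨ ·-linearˡ μ l y c ⟩
        μ · y - c * (l · y)   ≈⟨ +-congˡ (-‿cong (trans (*-congˡ ly≈1)
                                   (trans (*-identityʳ c) (*-comm _ β)))) ⟩
        μ · y - β * (μ · g)   ≈⟨ ·-linearʳ μ y g β ⟨
        μ · (y -ᵛ β *ᵛ g)     ≈⟨ μy′≈1 ⟩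
        1#                    ∎

  solvable⊎obstructed : ∀ {k} n (G : Fin k → Vect n) y → Solvable G y ⊎ Obstructed G y
  solvable⊎obstructed zero G y = solvable⊎obstructed-0 G y
  solvable⊎obstructed (suc n) G y with solvable⊎obstructed n (tail ∘ G) y
  ... | inj₁ sol = inj₁ (solvable-extend G y sol)
  ... | inj₂ (l , lG′≈0 , ly≈1) with (l · (head ∘ G)) ≟0
  ...   | yes α≈0 = inj₂ (l , (λ { zero → α≈0 ; (suc j) → lG′≈0 j }) , ly≈1)
  ...   | no α≉0 with inverse _ α≉0
  ...     | β , αβ≈1 with solvable⊎obstructed n (tail ∘ G) (y -ᵛ β *ᵛ (head ∘ G))
  ...       | inj₁ sol = inj₁ (solvable-shift G y β sol)
  ...       | inj₂ (μ , μG′≈0 , μy′≈1) =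
    inj₂ (obstructed-combine G y l μ β lG′≈0 ly≈1 αβ≈1 μG′≈0 μy′≈1)

  independentRows⇒solvable : ∀ {k n} (G : Fin k → Vect n) →
    (∀ l → (∀ j → l · (λ i → G i j) ≈ 0#) → ∀ i → l i ≈ 0#) → ∀ y → Solvable G y
  independentRows⇒solvable G independent y with solvable⊎obstructed _ G y
  ... | inj₁ solvable = solvable
  ... | inj₂ (l , lG≈0 , ly≈1) = ⊥-elim (0≉1 (begin
    0#     ≈⟨ ∑-zero (λ i → trans (*-congʳ (independent l lG≈0 i)) (zeroˡ _)) ⟨
    l · y  ≈⟨ ly≈1 ⟩
    1#     ∎))

module RankMetric (L : Field) (K : FieldTheory.Subfield L) where
  open Field L hiding (zero)
  open FieldTheory L
  open Subfield K
  open OverSubfield K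
  open FiniteSums L
  open RingProperties ring using (-0#≈0#)
  open SetoidReasoning setoid

  RankCoveringRadius≤ : ∀ {n} → (Vect n → Set) → ℕ → Set
  RankCoveringRadius≤ {n} D s = ∀ (x : Vect n) → ∃[ c ] (D c × RankWeight≤ (x -ᵛ c) s)

  RankCoveringRadius> : ∀ {n} → (Vect n → Set) → ℕ → Set
  RankCoveringRadius> D s = ∃[ x ] (∀ c → D c → ¬ RankWeight≤ (x -ᵛ c) s)

  far⇒¬covering : ∀ {n s} {D : Vect n → Set} →
    RankCoveringRadius> D s → ¬ RankCoveringRadius≤ D s
  far⇒¬covering (x , far) covering = let (c , c∈D , rank) = covering x in far c c∈D rank

  RankWeight≤-resp : ∀ {n s} {x y : Vect n} → x ≈ᵛ y → RankWeight≤ x s → RankWeight≤ y s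
  RankWeight≤-resp x≈y (b , x∈span) =
    b , λ j → proj₁ (x∈span j) , trans (sym (x≈y j)) (proj₂ (x∈span j))

  RankWeight≤-zero : ∀ {n s} {x : Vect n} → x ≈ᵛ 0ᵛ → RankWeight≤ x s
  RankWeight≤-zero {s = s} x≈0 = (λ _ → 0#) , λ j →
    ((λ _ → 0#) , λ _ → 0∈) , trans (x≈0 j) (sym (∑-zero {s} (λ _ → zeroˡ 0#)))

  RankWeight≤-suc : ∀ {n s} {x : Vect n} → RankWeight≤ x s → RankWeight≤ x (suc s)
  RankWeight≤-suc (b , x∈span) = 0# ∷ b , λ j →
    let ((a , a∈K) , xⱼ≈) = x∈span j in
    (0# ∷ a , λ { zero → 0∈ ; (suc t) → a∈K t }) ,
    trans xⱼ≈ (sym (trans (+-congʳ (zeroˡ 0#)) (+-identityˡ _)))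

  RankWeight≤-mono : ∀ {n s s′} {x : Vect n} → s ≤′ s′ → RankWeight≤ x s → RankWeight≤ x s′
  RankWeight≤-mono (≤′-reflexive ≡.refl) = λ rank → rank
  RankWeight≤-mono (≤′-step s≤s′)        = RankWeight≤-suc ∘ RankWeight≤-mono s≤s′

  RankCoveringRadius≤-mono : ∀ {n s s′} {D : Vect n → Set} → s ≤ s′ →
    RankCoveringRadius≤ D s → RankCoveringRadius≤ D s′
  RankCoveringRadius≤-mono s≤s′ covering x =
    let (c , c∈D , rank) = covering x in c , c∈D , RankWeight≤-mono (≤⇒≤′ s≤s′) rank

  -- G is a parity-check matrix of C^⊥, so Gx is the syndrome of x.
  syndrome : ∀ {k n} → Matrix k n → Vect n → Vect k
  syndrome G x i = x · G i

  syndrome--ᵛ : ∀ {k n} (G : Matrix k n) x c →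
                syndrome G (x -ᵛ c) ≈ᵛ (syndrome G x -ᵛ syndrome G c)
  syndrome--ᵛ G x c i = -ᵛ-· x c (G i)

  syndrome-dual : ∀ {k n} (G : Matrix k n) x {c} →
                  InDual G c → syndrome G (x -ᵛ c) ≈ᵛ syndrome G x
  syndrome-dual G x {c} c∈dual i = begin
    syndrome G (x -ᵛ c) i                ≈⟨ syndrome--ᵛ G x c i ⟩
    syndrome G x i - syndrome G c i      ≈⟨ +-congˡ (-‿cong (c∈dual i)) ⟩
    syndrome G x i - 0#                  ≈⟨ +-congˡ -0#≈0# ⟩
    syndrome G x i + 0#                  ≈⟨ +-identityʳ _ ⟩
    syndrome G x i                       ∎

  InSpanOfSystem : ∀ {k n} → Matrix k n → ℕ → Vect k → Set
  InSpanOfSystem {k} G s y = Σ (Fin s → Vect k) λ u →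
    (∀ t → InSystem G (u t)) × Σ (Vect s) λ λs → y ≈ᵛ (λ i → ∑ (λ t → λs t * u t i))

  InSpanOfPoints : ∀ {k n} → Matrix k n → ℕ → Vect k → Set
  InSpanOfPoints {k} G s y = Σ (Fin s → Vect k) λ u →
    (∀ t → InSystem G (u t) × ¬ (u t ≈ᵛ 0ᵛ)) ×
    Σ (Vect s) λ λs → y ≈ᵛ (λ i → ∑ (λ t → λs t * u t i))

  inSpanOfPoints⇒inSpanOfSystem : ∀ {k n s} {G : Matrix k n} {y} →
    InSpanOfPoints G s y → InSpanOfSystem G s y
  inSpanOfPoints⇒inSpanOfSystem (u , u∈L_U , λs , y≈) = u , proj₁ ∘ u∈L_U , λs , y≈

  InSpanOfSystem-resp : ∀ {k n s} {G : Matrix k n} {y y′} →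
    y ≈ᵛ y′ → InSpanOfSystem G s y → InSpanOfSystem G s y′
  InSpanOfSystem-resp y≈y′ (u , u∈U , λs , y≈) =
    u , u∈U , λs , λ i → trans (sym (y≈y′ i)) (y≈ i)

  syndrome-combination : ∀ {k n s} (G : Matrix k n) (a : Fin s → Vect n) (λs : Vect s) →
    syndrome G (λ j → ∑ (λ t → a t j * λs t)) ≈ᵛ (λ i → ∑ (λ t → λs t * (a t · G i)))
  syndrome-combination G a λs i = begin
    ∑ (λ j → ∑ (λ t → a t j * λs t) * G i j)
      ≈⟨ ∑-cong (λ j → *-distribʳ-∑ (G i j) (λ t → a t j * λs t)) ⟩
    ∑ (λ j → ∑ (λ t → (a t j * λs t) * G i j))
      ≈⟨ ∑-swap (λ j t → (a t j * λs t) * G i j) ⟩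
    ∑ (λ t → ∑ (λ j → (a t j * λs t) * G i j))
      ≈⟨ ∑-cong (λ t → ∑-cong (λ j → reassociate (a t j) (λs t) (G i j))) ⟩
    ∑ (λ t → ∑ (λ j → λs t * (a t j * G i j)))
      ≈⟨ ∑-cong (λ t → *-distribˡ-∑ (λs t) (λ j → a t j * G i j)) ⟨
    ∑ (λ t → λs t * (a t · G i))
      ∎
    where
    reassociate : ∀ x y z → (x * y) * z ≈ y * (x * z)
    reassociate x y z = trans (*-congʳ (*-comm x y)) (*-assoc y x z)

  rankWeight≤⇒inSpanOfSystem : ∀ {k n s} (G : Matrix k n) {x} →
    RankWeight≤ x s → InSpanOfSystem G s (syndrome G x)
  rankWeight≤⇒inSpanOfSystem {s = s} G {x} (b , x∈span) = u , u∈U , b , λ i →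
    trans (∑-cong (λ j → *-congʳ (proj₂ (x∈span j)))) (syndrome-combination G a b i)
    where
    a : Fin s → Vect _
    a t j = proj₁ (proj₁ (x∈span j)) t
    u : Fin s → Vect _
    u t = syndrome G (a t)
    u∈U : ∀ t → InSystem G (u t)
    u∈U t = (a t , λ j → proj₂ (proj₁ (x∈span j)) t) , λ i → refl

  inSpanOfSystem⇒rankWeight≤ : ∀ {k n s} (G : Matrix k n) {y} →
    InSpanOfSystem G s y → ∃[ x ] (RankWeight≤ x s × syndrome G x ≈ᵛ y)
  inSpanOfSystem⇒rankWeight≤ {s = s} G {y} (u , u∈U , λs , y≈) =
    x , (λs , λ j → ((λ t → a t j) , λ t → proj₂ (proj₁ (u∈U t)) j) , refl) , λ i → begin
      syndrome G x i                 ≈⟨ syndrome-combination G a λs i ⟩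
      ∑ (λ t → λs t * (a t · G i))   ≈⟨ ∑-cong (λ t → *-congˡ (proj₂ (u∈U t) i)) ⟨
      ∑ (λ t → λs t * u t i)         ≈⟨ y≈ i ⟨
      y i                            ∎
    where
    a : Fin s → Vect _
    a t = proj₁ (proj₁ (u∈U t))
    x : Vect _
    x j = ∑ (λ t → a t j * λs t)

  δ∈K : ∀ {n} (i j : Fin n) → inK (δ i j)
  δ∈K zero    zero    = 1∈
  δ∈K zero    (suc j) = 0∈
  δ∈K (suc i) zero    = 0∈
  δ∈K (suc i) (suc j) = δ∈K i j

  column∈system : ∀ {k n} (G : Matrix k n) j → InSystem G (column G j)
  column∈system G j = (δ j , δ∈K j) , λ i → sym (δ-· j (G i))

  column≉0 : ∀ {k n} (G : Matrix k n) → Nondegenerate G → ∀ j → ¬ (column G j ≈ᵛ 0ᵛ)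
  column≉0 G nondegenerate j column≈0 =
    0≉1 (sym (trans (reflexive (≡.sym (δ-diagonal j)))
      (nondegenerate (δ j , δ∈K j) (λ i → trans (δ-· j (G i)) (column≈0 i)) j)))

  ¬everyPointInSpanOf-0 : ∀ {k n} (G : Matrix (suc k) n) → ¬ EveryPointInSpanOf G 0
  ¬everyPointInSpanOf-0 G everyPoint =
    let (_ , _ , _ , δ≈0) = everyPoint (δ zero) (λ δ≈0 → 0≉1 (sym (δ≈0 zero)))
    in 0≉1 (sym (δ≈0 zero))

module FiniteExtension (L : Field) (K : FieldTheory.Subfield L) {q m : ℕ}
    (card : FieldTheory.OverSubfield.HasCardinality L K q)
    (deg : FieldTheory.OverSubfield.HasDegree L K m) where
  open Field L hiding (zero)
  open FieldTheory L
  open Subfield K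
  open OverSubfield K
  open FiniteSums L
  open RankMetric L K
  open RingProperties ring using (x∙y⁻¹≈ε⇒x≈y; x≈y⇒x∙y⁻¹≈ε; ⁻¹-anti-homo‿-; xyx⁻¹≈y)
  open SetoidReasoning setoid

  private
    e : Fin q → Carrier
    e = proj₁ card
    e∈K : ∀ i → inK (e i)
    e∈K = proj₁ (proj₂ card)
    e-injective : ∀ i j → e i ≈ e j → i ≡ j
    e-injective = proj₁ (proj₂ (proj₂ card))
    index : ∀ {x} → inK x → Fin q
    index {x} x∈K = proj₁ (proj₂ (proj₂ (proj₂ card)) x x∈K)
    index-spec : ∀ {x} (x∈K : inK x) → x ≈ e (index x∈K)
    index-spec {x} x∈K = proj₂ (proj₂ (proj₂ (proj₂ card)) x x∈K)
    basis : Vect m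
    basis = proj₁ deg
    basis-independent : KIndependent basis
    basis-independent = proj₁ (proj₂ deg)
    basis-spans : ∀ x → InKSpan basis x
    basis-spans = proj₂ (proj₂ deg)

  -- x ≈ 0 iff all its K-coordinates are 0, and equality in K = {e i} is
  -- equality of indices.
  _≟0 : ∀ x → Dec (x ≈ 0#)
  x ≟0 with basis-spans x
  ... | (a , a∈K) , x≈ =
    map′ zero-coordinates⇒x≈0 x≈0⇒zero-coordinates (all? (λ i → index (a∈K i) ≟ᶠ index 0∈))
    where
    zero-coordinates⇒x≈0 : (∀ i → index (a∈K i) ≡ index 0∈) → x ≈ 0#
    zero-coordinates⇒x≈0 a≡0 = trans x≈ (∑-zero λ i → trans (*-congʳ (begin
      a i               ≈⟨ index-spec (a∈K i) ⟩
      e (index (a∈K i)) ≡⟨ ≡.cong e (a≡0 i) ⟩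
      e (index 0∈)      ≈⟨ index-spec 0∈ ⟨
      0#                ∎)) (zeroˡ _))
    x≈0⇒zero-coordinates : x ≈ 0# → ∀ i → index (a∈K i) ≡ index 0∈
    x≈0⇒zero-coordinates x≈0 i = e-injective _ _ (begin
      e (index (a∈K i)) ≈⟨ index-spec (a∈K i) ⟨
      a i               ≈⟨ basis-independent (a , a∈K) (trans (sym x≈) x≈0) i ⟩
      0#                ≈⟨ index-spec 0∈ ⟩
      e (index 0∈)      ∎)

  _≟_ : ∀ x y → Dec (x ≈ y)
  x ≟ y = map′ (x∙y⁻¹≈ε⇒x≈y x y) x≈y⇒x∙y⁻¹≈ε ((x - y) ≟0)

  _≟ᵛ_ : ∀ {n} (x y : Vect n) → Dec (x ≈ᵛ y)
  x ≟ᵛ y = all? (λ i → x i ≟ y i)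

  Code-searchable : ∀ s → Searchable (Fin s → Fin q) (Pointwise _≡_)
  Code-searchable = →-searchable ≡.refl (Fin-searchable q)

  Carrier-searchable : Searchable Carrier _≈_
  Carrier-searchable = image-searchable (Code-searchable m) (λ c → ∑ (λ i → e (c i) * basis i))
    (λ c≡c′ → ∑-cong (λ i → *-congʳ (reflexive (≡.cong e (c≡c′ i)))))
    (λ x → let ((a , a∈K) , x≈) = basis-spans x in
      (λ i → index (a∈K i)) , trans x≈ (∑-cong (λ i → *-congʳ (index-spec (a∈K i)))))

  Vect-searchable : ∀ n → Searchable (Vect n) _≈ᵛ_
  Vect-searchable = →-searchable refl Carrier-searchable

  KCoeffs-searchable : ∀ s → Searchable (KCoeffs s) (λ a a′ → proj₁ a ≈ᵛ proj₁ a′)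
  KCoeffs-searchable s = image-searchable (Code-searchable s) (λ c → e ∘ c , e∈K ∘ c)
    (λ c≡c′ i → reflexive (≡.cong e (c≡c′ i)))
    (λ (a , a∈K) → (λ i → index (a∈K i)) , λ i → index-spec (a∈K i))

  InKSpan? : ∀ {s} (b : Vect s) x → Dec (InKSpan b x)
  InKSpan? b x = KCoeffs-searchable _ (λ a → x ≈ ∑ (λ t → proj₁ a t * b t))
    (λ a≈a′ x≈ → trans x≈ (∑-cong (λ t → *-congʳ (a≈a′ t))))
    (λ a → x ≟ ∑ (λ t → proj₁ a t * b t))

  RankWeight≤? : ∀ {n} s (x : Vect n) → Dec (RankWeight≤ x s)
  RankWeight≤? s x = Vect-searchable s (λ b → ∀ j → InKSpan b (x j))
    (λ b≈b′ x∈span j → let (a , xⱼ≈) = x∈span j in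
      a , trans xⱼ≈ (∑-cong (λ t → *-congˡ (b≈b′ t))))
    (λ b → all? (λ j → InKSpan? b (x j)))

  ¬covering⇒far : ∀ {n s} {D : Vect n → Set} → D Respects _≈ᵛ_ → Decidable D →
    ¬ RankCoveringRadius≤ D s → RankCoveringRadius> D s
  ¬covering⇒far {n} {s} {D} D-resp D? ¬covering
    with counterexample (Vect-searchable n) (λ x≈y i → sym (x≈y i))
           Covered Covered-resp Covered? ¬covering
    where
    Covered : Vect n → Set
    Covered x = ∃[ c ] (D c × RankWeight≤ (x -ᵛ c) s)
    Covered-resp : Covered Respects _≈ᵛ_
    Covered-resp x≈x′ (c , c∈D , rank) =
      c , c∈D , RankWeight≤-resp (λ j → +-congʳ (x≈x′ j)) rank
    Covered? : Decidable Covered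
    Covered? x = Vect-searchable n (λ c → D c × RankWeight≤ (x -ᵛ c) s)
      (λ c≈c′ (c∈D , rank) →
        D-resp c≈c′ c∈D , RankWeight≤-resp (λ j → +-congˡ (-‿cong (c≈c′ j))) rank)
      (λ c → D? c ×-dec RankWeight≤? s (x -ᵛ c))
  ... | x , ¬covered = x , λ c c∈D rank → ¬covered (c , c∈D , rank)

  open FredholmAlternative L _≟0 using (independentRows⇒solvable)

  InDual-resp : ∀ {k n} (G : Matrix k n) → InDual G Respects _≈ᵛ_
  InDual-resp G c≈c′ c∈dual i = trans (∑-cong (λ j → *-congʳ (sym (c≈c′ j)))) (c∈dual i)

  InDual? : ∀ {k n} (G : Matrix k n) → Decidable (InDual G)
  InDual? G c = all? (λ i → syndrome G c i ≟0)

  -- Zero vectors among the u t are replaced by the point u₀, with coefficient 0.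
  inSpanOfSystem⇒inSpanOfPoints : ∀ {k n s} {G : Matrix k n} {y} u₀ →
    InSystem G u₀ → ¬ (u₀ ≈ᵛ 0ᵛ) → InSpanOfSystem G s y → InSpanOfPoints G s y
  inSpanOfSystem⇒inSpanOfPoints {k} {s = s} {G} u₀ u₀∈U u₀≉0 (u , u∈U , λs , y≈) =
    u′ , u′∈L_U , λs′ , λ i → trans (y≈ i) (∑-cong (λ t → same-term t i))
    where
    u′ : Fin s → Vect k
    u′ t with u t ≟ᵛ 0ᵛ
    ... | yes _ = u₀
    ... | no _  = u t
    λs′ : Vect s
    λs′ t with u t ≟ᵛ 0ᵛ
    ... | yes _ = 0#
    ... | no _  = λs t
    u′∈L_U : ∀ t → InSystem G (u′ t) × ¬ (u′ t ≈ᵛ 0ᵛ)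
    u′∈L_U t with u t ≟ᵛ 0ᵛ
    ... | yes _   = u₀∈U , u₀≉0
    ... | no uₜ≉0 = u∈U t , uₜ≉0
    same-term : ∀ t i → λs t * u t i ≈ λs′ t * u′ t i
    same-term t i with u t ≟ᵛ 0ᵛ
    ... | yes uₜ≈0 = trans (*-congˡ (uₜ≈0 i)) (trans (zeroʳ _) (sym (zeroˡ _)))
    ... | no _     = refl

  everyPoint⇒covering : ∀ {k n s} (G : Matrix k n) →
    EveryPointInSpanOf G s → RankCoveringRadius≤ (InDual G) s
  everyPoint⇒covering G everyPoint x with syndrome G x ≟ᵛ 0ᵛ
  ... | yes x∈dual = x , x∈dual , RankWeight≤-zero (λ j → -‿inverseʳ (x j))
  ... | no x∉dual =
    let (err , err-rank , G·err≈Gx) = inSpanOfSystem⇒rankWeight≤ G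
          (inSpanOfPoints⇒inSpanOfSystem (everyPoint (syndrome G x) x∉dual))
    in x -ᵛ err , (λ i → trans (syndrome--ᵛ G x err i) (x≈y⇒x∙y⁻¹≈ε (sym (G·err≈Gx i)))) ,
       RankWeight≤-resp (λ j → sym (x-[x-y]≈y (x j) (err j))) err-rank
    where
    x-[x-y]≈y : ∀ x y → x - (x - y) ≈ y
    x-[x-y]≈y x y = begin
      x - (x - y)   ≈⟨ +-congˡ (⁻¹-anti-homo‿- x y) ⟩
      x + (y - x)   ≈⟨ +-assoc x y (- x) ⟨
      x + y - x     ≈⟨ xyx⁻¹≈y x y ⟩
      y             ∎

  covering⇒everyPoint : ∀ {k n s} (G : Matrix k (suc n)) → FullRowRank G → Nondegenerate G →
    RankCoveringRadius≤ (InDual G) s → EveryPointInSpanOf G s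
  covering⇒everyPoint G fullRowRank nondegenerate covering y _ =
    let (x , Gx≈y)               = independentRows⇒solvable G fullRowRank y
        (c , c∈dual , x-c-rank)  = covering x
    in inSpanOfSystem⇒inSpanOfPoints {G = G} (column G zero)
         (column∈system G zero) (column≉0 G nondegenerate zero)
         (InSpanOfSystem-resp {G = G} (λ i → trans (syndrome-dual G x {c} c∈dual i) (Gx≈y i))
           (rankWeight≤⇒inSpanOfSystem G x-c-rank))

  rankSaturating⇔rankCoveringRadius : ∀ {k n r} (G : Matrix (suc k) (suc n)) →
    FullRowRank G → Nondegenerate G →
    RankSaturating G (suc r) ⇔ RankCoveringRadius (InDual G) (suc r)
  rankSaturating⇔rankCoveringRadius {r = r} G fullRowRank nondegenerate = mk⇔
    (λ (everyPoint , minimal) → everyPoint⇒covering G everyPoint ,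
      ¬covering⇒far (InDual-resp G) (InDual? G) (¬everyPoint r minimal ∘ covering⇒everyPoint′))
    (λ (covering , far) → covering⇒everyPoint′ covering , λ r′ r′<r everyPoint →
      far⇒¬covering far (RankCoveringRadius≤-mono r′<r (everyPoint⇒covering G everyPoint)))
    where
    covering⇒everyPoint′ : ∀ {s} → RankCoveringRadius≤ (InDual G) s → EveryPointInSpanOf G s
    covering⇒everyPoint′ = covering⇒everyPoint G fullRowRank nondegenerate
    ¬everyPoint : ∀ r → (∀ r′ → r′ < r → ¬ EveryPointInSpanOf G (suc r′)) →
      ¬ EveryPointInSpanOf G r
    ¬everyPoint zero    _       = ¬everyPointInSpanOf-0 G
    ¬everyPoint (suc r) minimal = minimal r (n<1+n r)

theorem2p5 : (L : Field) → let open FieldTheory L in (K : Subfield) →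
    let open OverSubfield K in
    (q m n k ρ : ℕ) → IsPrimePower q → HasCardinality q → HasDegree m →
    NonZero m → NonZero n → NonZero k → NonZero ρ →
    (G : Matrix k n) → FullRowRank G → Nondegenerate G →
    RankSaturating G ρ ⇔ RankCoveringRadius (InDual G) ρ
theorem2p5 L K q m (suc n) (suc k) (suc r) _ card deg _ _ _ _ =
  FiniteExtension.rankSaturating⇔rankCoveringRadius L K card deg
theorem2p5 L K q m zero    _       _       _ _ _ _ () _  _  _
theorem2p5 L K q m (suc n) zero    _       _ _ _ _ _  () _  _
theorem2p5 L K q m (suc n) (suc k) zero    _ _ _ _ _  _  ()
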